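{- Let $G=(V,E)$ be an undirected graph and $S\subseteq V$. Let $\mathcal{P}^0_S=S\cup nbr(S)$, and let $\mathcal{P}^0_S\subseteq\mathcal{P}^1_S\subseteq\cdots\subseteq\mathcal{P}^k_S$ be obtained by a sequence of applications of the propagation rule, i.e. for each $0\le i<k$ there are $v\in\mathcal{P}^i_S$ and $u\notin\mathcal{P}^i_S$ such that $u$ is the only neighbor of $v$ not in $\mathcal{P}^i_S$, and $\mathcal{P}^{i+1}_S=\mathcal{P}^i_S\cup\{u\}$, and suppose $\mathcal{P}^k_S=\mathcal{P}_S$. Then $|ext(\mathcal{P}^j_S)|\le|ext(\mathcal{P}^i_S)|$ for all $0\le i<j\le k$.
   Context: $\mathcal{P}_S$ is the set of nodes power dominated by $S$: (Rule 1) every node of $S$ and every neighbor of a node of $S$ is in $\mathcal{P}_S$; (Rule 2) repeatedly, if $v\in\mathcal{P}_S$ and all neighbors of $v$ except exactly one neighbor $w$ are in $\mathcal{P}_S$, insert $w$. For $R\subseteq V$, $nbr(R)=\{v\in V\setminus R: v$ adjacent to some $u\in R\}$ and $ext(R)=nbr(V\setminus R)$, the set of nodes of $R$ adjacent to some node of $V\setminus R$. -}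

module Defs where

open import Data.Nat using (ℕ; zero; suc)
open import Data.Bool using (Bool; true; false; _∧_; _∨_; not)
open import Data.Fin using (Fin; zero; suc)
open import Data.Fin.Subset using (Subset; _∈_; _∉_; _∪_; ⁅_⁆)
open import Data.Vec using (Vec; tabulate; lookup)
open import Data.Product using (Σ; _×_; ∃₂)
open import Relation.Binary.PropositionalEquality using (_≡_; _≢_)

record Graph (n : ℕ) : Set where
  field
    adj   : Fin n → Fin n → Bool
    sym   : ∀ u v → adj u v ≡ adj v u
    irrefl : ∀ v → adj v v ≡ false
open Graph public

anyFin : ∀ {n} → (Fin n → Bool) → Bool
anyFin {zero}  f = false
anyFin {suc n} f = f zero ∨ anyFin (λ i → f (suc i))

module _ {n : ℕ} (G : Graph n) where

  nbr : Subset n → Subset n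
  nbr R = tabulate λ v → not (lookup R v) ∧ anyFin (λ u → lookup R u ∧ adj G u v)

  -- ext(R) = nbr(V \ R) = { v ∈ R : v adjacent to some u ∉ R }
  ext : Subset n → Subset n
  ext R = tabulate λ v → lookup R v ∧ anyFin (λ u → not (lookup R u) ∧ adj G u v)

  P0 : Subset n → Subset n
  P0 S = S ∪ nbr S

  PropStep : Subset n → Subset n → Set
  PropStep A B = ∃₂ λ v u →
    (v ∈ A) × (u ∉ A) × (adj G v u ≡ true)
    × (∀ w → adj G v w ≡ true → w ∉ A → w ≡ u)
    × (B ≡ A ∪ ⁅ u ⁆)

  -- 𝒫_S: the set of nodes power dominated by S (least set closed under Rules 1, 2).
  data InP (S : Subset n) : Fin n → Set where
    rule1-self : ∀ {v} → v ∈ S → InP S v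
    rule1-nbr  : ∀ {u v} → u ∈ S → adj G u v ≡ true → InP S v
    rule2      : ∀ {v w} → InP S v → adj G v w ≡ true
               → (∀ x → adj G v x ≡ true → x ≢ w → InP S x) → InP S w

-- Forcing v ↦ u removes v from the exterior (all neighbours of v now lie inside)
-- and can add at most the new vertex u: every other vertex that is exterior after
-- the step was already exterior before, as the outside only shrank.  So each step
-- does not increase |ext|, and monotonicity along the chain follows.
module Submission where

open import Defs
open import Data.Bool using (Bool; true; false; _∧_; not)
open import Data.Nat using (ℕ; zero; suc; _<_; _≤_; z≤n; s≤s)
open import Data.Nat.Properties using (≤-refl; ≤-trans; n≤1+n; <⇒≤; m≤n⇒m<n∨m≡n)
open import Data.Fin using (Fin; zero; suc)
open import Data.Fin.Properties using (_≟_)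
open import Data.Fin.Subset using (Subset; _∈_; _∉_; _∪_; _-_; ⁅_⁆; _⊆_; ∣_∣; inside; outside)
open import Data.Fin.Subset.Properties
  using (∪-identityʳ; x∈⁅x⁆; x∈⁅y⁆⇒x≡y; x∈p∪q⁻; x∈p∪q⁺; x∈p∧x≢y⇒x∈p-y; x∈p⇒∣p-x∣<∣p∣; p⊆q⇒∣p∣≤∣q∣)
open import Data.Vec using (_∷_; lookup)
open import Data.Vec.Properties using (lookup∘tabulate; []=⇒lookup; lookup⇒[]=)
open import Data.Product using (∃; _×_; _,_)
open import Data.Sum using (inj₁; inj₂)
open import Relation.Binary.PropositionalEquality using (_≡_; _≢_; refl; trans; subst)
  renaming (sym to ≡-sym)
open import Relation.Nullary using (yes; no; contradiction)

∧-true⁻ : ∀ {a b} → a ∧ b ≡ true → a ≡ true × b ≡ true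
∧-true⁻ {true} {true} refl = refl , refl

not-true⁻ : ∀ {a} → not a ≡ true → a ≡ false
not-true⁻ {false} refl = refl

anyFin-true⁻ : ∀ {n} (f : Fin n → Bool) → anyFin f ≡ true → ∃ λ i → f i ≡ true
anyFin-true⁻ {suc n} f any with f zero in f0
... | true  = zero , f0
... | false with anyFin-true⁻ (λ i → f (suc i)) any
...   | i , fi = suc i , fi

anyFin-true⁺ : ∀ {n} (f : Fin n → Bool) i → f i ≡ true → anyFin f ≡ true
anyFin-true⁺ f zero    fi rewrite fi = refl
anyFin-true⁺ f (suc i) fi with f zero
... | true  = refl
... | false = anyFin-true⁺ (λ j → f (suc j)) i fi

lookup-false⇒∉ : ∀ {n} {p : Subset n} {x} → lookup p x ≡ false → x ∉ p
lookup-false⇒∉ px x∈p with trans (≡-sym px) ([]=⇒lookup x∈p)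
... | ()

∉⇒lookup-false : ∀ {n} {p : Subset n} {x} → x ∉ p → lookup p x ≡ false
∉⇒lookup-false {p = p} {x} x∉p with lookup p x in px
... | true  = contradiction (lookup⇒[]= x p px) x∉p
... | false = refl

∣p∪⁅x⁆∣≤1+∣p∣ : ∀ {n} (p : Subset n) (x : Fin n) → ∣ p ∪ ⁅ x ⁆ ∣ ≤ suc ∣ p ∣
∣p∪⁅x⁆∣≤1+∣p∣ (inside  ∷ p) zero    rewrite ∪-identityʳ p = n≤1+n _
∣p∪⁅x⁆∣≤1+∣p∣ (outside ∷ p) zero    rewrite ∪-identityʳ p = ≤-refl
∣p∪⁅x⁆∣≤1+∣p∣ (inside  ∷ p) (suc x) = s≤s (∣p∪⁅x⁆∣≤1+∣p∣ p x)
∣p∪⁅x⁆∣≤1+∣p∣ (outside ∷ p) (suc x) = ∣p∪⁅x⁆∣≤1+∣p∣ p x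

antitone-upTo : ∀ (f : ℕ → ℕ) k → (∀ i → i < k → f (suc i) ≤ f i)
              → ∀ {i j} → i ≤ j → j ≤ k → f j ≤ f i
antitone-upTo f k step {j = zero}  z≤n  _ = ≤-refl
antitone-upTo f k step {j = suc j} i≤1+j 1+j≤k with m≤n⇒m<n∨m≡n i≤1+j
... | inj₂ refl      = ≤-refl
... | inj₁ (s≤s i≤j) = ≤-trans (step j 1+j≤k) (antitone-upTo f k step i≤j (<⇒≤ 1+j≤k))

module _ {n : ℕ} (G : Graph n) where

  ∈ext⁺ : ∀ {R x w} → x ∈ R → w ∉ R → adj G w x ≡ true → x ∈ ext G R
  ∈ext⁺ {R} {x} {w} x∈R w∉R wx = lookup⇒[]= x (ext G R) x∈extᵇ
    where
    outsideNbr : anyFin (λ u → not (lookup R u) ∧ adj G u x) ≡ true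
    outsideNbr = anyFin-true⁺ _ w (subst (λ b → not b ∧ adj G w x ≡ true) (≡-sym (∉⇒lookup-false w∉R)) wx)
    x∈extᵇ : lookup (ext G R) x ≡ true
    x∈extᵇ = trans (lookup∘tabulate _ x)
      (subst (λ b → b ∧ anyFin (λ u → not (lookup R u) ∧ adj G u x) ≡ true)
             (≡-sym ([]=⇒lookup x∈R)) outsideNbr)

  ∈ext⁻ : ∀ {R x} → x ∈ ext G R → x ∈ R × ∃ λ w → w ∉ R × adj G w x ≡ true
  ∈ext⁻ {R} {x} x∈ext with ∧-true⁻ (trans (≡-sym (lookup∘tabulate _ x)) ([]=⇒lookup x∈ext))
  ... | x∈Rᵇ , outsideNbr with anyFin-true⁻ _ outsideNbr
  ...   | w , w-ok with ∧-true⁻ w-ok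
  ...     | w∉Rᵇ , wx = lookup⇒[]= x R x∈Rᵇ , w , lookup-false⇒∉ (not-true⁻ w∉Rᵇ) , wx

  ext-∪⁅forced⁆⊆ : ∀ {A v u} → u ∉ A → (∀ w → adj G v w ≡ true → w ∉ A → w ≡ u)
                 → ext G (A ∪ ⁅ u ⁆) ⊆ (ext G A - v) ∪ ⁅ u ⁆
  ext-∪⁅forced⁆⊆ {A} {v} {u} u∉A only {x} x∈ext with ∈ext⁻ x∈ext | x ≟ u
  ... | _ | yes refl = x∈p∪q⁺ (inj₂ (x∈⁅x⁆ u))
  ... | x∈A∪u , w , w∉A∪u , wx | no x≢u =
    x∈p∪q⁺ (inj₁ (x∈p∧x≢y⇒x∈p-y (∈ext⁺ x∈A w∉A wx) x≢v))
    where
    w∉A : w ∉ A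
    w∉A w∈A = w∉A∪u (x∈p∪q⁺ (inj₁ w∈A))
    x∈A : x ∈ A
    x∈A with x∈p∪q⁻ A ⁅ u ⁆ x∈A∪u
    ... | inj₁ x∈A  = x∈A
    ... | inj₂ x∈⁅u⁆ = contradiction (x∈⁅y⁆⇒x≡y u x∈⁅u⁆) x≢u
    x≢v : x ≢ v
    x≢v refl with only w (trans (Graph.sym G x w) wx) w∉A
    ... | refl = w∉A∪u (x∈p∪q⁺ (inj₂ (x∈⁅x⁆ u)))

  ∣ext∣-PropStep : ∀ {A B} → PropStep G A B → ∣ ext G B ∣ ≤ ∣ ext G A ∣
  ∣ext∣-PropStep {A} (v , u , v∈A , u∉A , vu , only , refl) = begin
    ∣ ext G (A ∪ ⁅ u ⁆) ∣       ≤⟨ p⊆q⇒∣p∣≤∣q∣ (ext-∪⁅forced⁆⊆ u∉A only) ⟩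
    ∣ (ext G A - v) ∪ ⁅ u ⁆ ∣   ≤⟨ ∣p∪⁅x⁆∣≤1+∣p∣ (ext G A - v) u ⟩
    suc ∣ ext G A - v ∣         ≤⟨ x∈p⇒∣p-x∣<∣p∣ (∈ext⁺ v∈A u∉A (trans (Graph.sym G u v) vu)) ⟩
    ∣ ext G A ∣                 ∎
    where open Data.Nat.Properties.≤-Reasoning

lemma7 : ∀ {n : ℕ} (G : Graph n) (S : Subset n) (k : ℕ) (P : ℕ → Subset n)
    → P 0 ≡ P0 G S
    → (∀ i → i < k → PropStep G (P i) (P (ℕ.suc i)))
    → (∀ v → (v ∈ P k → InP G S v) × (InP G S v → v ∈ P k))
    → ∀ i j → i < j → j ≤ k → ∣ ext G (P j) ∣ ≤ ∣ ext G (P i) ∣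
lemma7 G S k P _ steps _ i j i<j j≤k =
  antitone-upTo (λ m → ∣ ext G (P m) ∣) k (λ m m<k → ∣ext∣-PropStep G (steps m m<k)) (<⇒≤ i<j) j≤k
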